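{- (a) For every rational $s\ge1$, $\operatorname{ltan}(\operatorname{larctan}s)=s$. (b) For every ordinary lattice angle $\alpha$, $\operatorname{larctan}(\operatorname{ltan}\alpha)$ is lattice-congruent to $\alpha$.
   Context: We work in $\mathbb R^2$ with lattice $\mathbb Z^2$, origin $O$ and standard basis $e_1,e_2$. A lattice-affine transformation is $x\mapsto Mx+b$, $M\in GL_2(\mathbb Z)$, $b\in\mathbb Z^2$. An ordinary lattice angle $\angle AOB$ ($A,O,B$ lattice points not on one line) is the ordered pair (ray $OA$, ray $OB$); two are lattice-congruent if a lattice-affine map sends vertex to vertex and first/second ray onto first/second ray. Lattice tangent: for $\angle AOB$ let $v_1,v_2$ be primitive lattice vectors along $OA$, $OB$; the lattice points $P$ with $(v_1,P-O)$ a basis of $\mathbb Z^2$ form two lines parallel to $OA$; ray $OB$ meets exactly one, $l$, at $Q$; let $D$ be the lattice point of $l$ nearest $Q$ among those strictly on the other side of line $OB$ from $A$; writing $v_2=x_1v_1+x_2(D-O)$ ($x_1,x_2\in\mathbb Z$), $\operatorname{ltan}\angle AOB=x_2/x_1$. Lattice arctangent: for a rational $p\ge1$ write $p=m/n$ with $m,n$ positive integers; $\operatorname{larctan}p$ is the ordinary lattice angle $\angle AOB$ with $A=O+e_1$, $B=O+ne_1+me_2$. -}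

module Defs where

open import Data.Nat as ℕ using (ℕ; suc)
import Data.Nat.GCD as ℕG
open import Data.Integer as ℤ using (ℤ; +_; ∣_∣)
open import Data.Rational as ℚ using (ℚ; ↥_; ↧ₙ_)
open import Data.Product using (Σ; _×_; _,_; ∃; ∃-syntax)
open import Data.Sum using (_⊎_)
open import Relation.Binary.PropositionalEquality using (_≡_; _≢_)

-- Lattice points / vectors of ℤ², and rational points of ℚ²
-- (the ray OB meets the line l at a point Q that is rational, so ℚ²
-- suffices for every non-lattice point occurring in the definitions)

Pt : Set
Pt = ℤ × ℤ

PtQ : Set
PtQ = ℚ × ℚ

px py : Pt → ℤ
px (a , _) = a
py (_ , b) = b

_⊖_ : Pt → Pt → Pt
(a , b) ⊖ (c , d) = (a ℤ.- c , b ℤ.- d)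

_⊕_ : Pt → Pt → Pt
(a , b) ⊕ (c , d) = (a ℤ.+ c , b ℤ.+ d)

_·_ : ℤ → Pt → Pt
k · (a , b) = (k ℤ.* a , k ℤ.* b)

det : Pt → Pt → ℤ
det (a , b) (c , d) = a ℤ.* d ℤ.- b ℤ.* c

ι : ℤ → ℚ
ι z = z ℚ./ 1

ιP : Pt → PtQ
ιP (a , b) = (ι a , ι b)

_⊖Q_ : PtQ → PtQ → PtQ
(a , b) ⊖Q (c , d) = (a ℚ.- c , b ℚ.- d)

detQ : PtQ → PtQ → ℚ
detQ (a , b) (c , d) = a ℚ.* d ℚ.- b ℚ.* c

dist² : PtQ → PtQ → ℚ
dist² P Q with P ⊖Q Q
... | (a , b) = a ℚ.* a ℚ.+ b ℚ.* b

Primitive : Pt → Set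
Primitive (a , b) = ℕG.gcd ∣ a ∣ ∣ b ∣ ≡ 1

PrimAlong : Pt → Pt → Pt → Set
PrimAlong O A v = Primitive v × Σ ℕ (λ k → (A ⊖ O) ≡ (+ suc k) · v)

NonCollinear : Pt → Pt → Pt → Set
NonCollinear A O B = det (A ⊖ O) (B ⊖ O) ≢ + 0

record GL2Z : Set where
  constructor mkGL
  field
    c₁ c₂  : Pt
    unimod : det c₁ c₂ ≡ + 1 ⊎ det c₁ c₂ ≡ ℤ.- + 1

act : GL2Z → Pt → Pt
act M (a , b) = (a · GL2Z.c₁ M) ⊕ (b · GL2Z.c₂ M)

SameDir : Pt → Pt → Set
SameDir u w = Σ ℕ λ k → Σ ℕ λ k' → (+ suc k) · u ≡ (+ suc k') · w

record Angle : Set where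
  constructor ∠
  field
    A O B : Pt

-- lattice congruence: a lattice-affine map x ↦ Mx + b sends the vertex to
-- the vertex, the first ray onto the first ray and the second ray onto the
-- second ray.  (An affine map sends the ray O→A to the ray f(O)→f(O)+M(A−O);
-- it coincides with the ray O'→A' iff f(O)=O' and M(A−O) is a positive
-- multiple of A'−O'.)
LatticeCongruent : Angle → Angle → Set
LatticeCongruent (∠ A O B) (∠ A' O' B') =
  Σ GL2Z λ M → Σ Pt λ b →
      (act M O ⊕ b ≡ O')
    × SameDir (act M (A ⊖ O)) (A' ⊖ O')
    × SameDir (act M (B ⊖ O)) (B' ⊖ O')

-- LTan α q : "ltan α = q".
--   v₁ , v₂ : primitive lattice vectors along OA, OB;
--   σ ∈ {1,-1} selects the line l = {P : det(v₁ , P − O) = σ}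
--     (the lattice points P with (v₁ , P − O) a basis form the two lines σ = ±1);
--   Q : the point where the ray OB meets l;
--   D : a lattice point of l strictly on the other side of line OB from A,
--       nearest to Q among all such lattice points;
--   v₂ = x₁ v₁ + x₂ (D − O) and q = x₂ / x₁.

OtherSide : Angle → Pt → Pt → Set
OtherSide (∠ A O B) v₂ P =
  det v₂ (P ⊖ O) ℤ.* det v₂ (A ⊖ O) ℤ.< + 0

LTan : Angle → ℚ → Set
LTan α@(∠ A O B) q =
  Σ Pt λ v₁ → Σ Pt λ v₂ → Σ ℤ λ σ → Σ PtQ λ Q → Σ Pt λ D → Σ ℤ λ x₁ → Σ ℤ λ x₂ →
      PrimAlong O A v₁
    × PrimAlong O B v₂
    × (σ ≡ + 1 ⊎ σ ≡ ℤ.- + 1)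
    × (Σ ℚ λ t → (0ℚ' ℚ.≤ t) × (Q ⊖Q ιP O) ≡ (t ℚ.* ι (px (B ⊖ O)) , t ℚ.* ι (py (B ⊖ O))))
    × (detQ (ιP v₁) (Q ⊖Q ιP O) ≡ ι σ)
    × (det v₁ (D ⊖ O) ≡ σ)
    × OtherSide α v₂ D
    × (∀ P → det v₁ (P ⊖ O) ≡ σ → OtherSide α v₂ P → dist² (ιP D) Q ℚ.≤ dist² (ιP P) Q)
    × (v₂ ≡ (x₁ · v₁) ⊕ (x₂ · (D ⊖ O)))
    × (x₁ ≢ + 0)
    × (q ℚ.* ι x₁ ≡ ι x₂)
  where
  0ℚ' : ℚ
  0ℚ' = ℚ.0ℚ

-- Lattice arctangent: for rational p ≥ 1 written p = m/n (m, n positive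
-- integers; we take the reduced form), larctan p = ∠AOB with O the origin,
-- A = O + e₁, B = O + n e₁ + m e₂.

larctan : (p : ℚ) → ℚ.1ℚ ℚ.≤ p → Angle
larctan p _ = ∠ (+ 1 , + 0) (+ 0 , + 0) (+ ↧ₙ p , ↥ p)

-- Read a lattice angle ∠AOB in a unimodular frame (v , w) at O: v is the primitive vector along
-- OA, the line l is {O + c v + w}, and the primitive vector along OB is x₁ v + x₂ w.  The point
-- O + c v + w of l lies across OB from A exactly when x₂ c < x₁, and x₂ times its distance to the
-- point Q where OB meets l is |x₂ c - x₁| |v|.  So D = O + w is the nearest such point exactly
-- when 0 < x₁ ≤ x₂; then ltan ∠AOB = x₂ / x₁ ≥ 1, and the lattice map e₁ ↦ v, e₂ ↦ w carries
-- larctan (x₂ / x₁), whose second ray is spanned by (x₁ , x₂), onto ∠AOB.  Every angle has such a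
-- frame (complete v to a basis by Bézout, then shear w), and for larctan s the frame is forced to
-- be (e₁ , e₂).

{-# OPTIONS --safe #-}
module Submission where

open import Defs
open import Data.Rational as ℚ using (ℚ; 1ℚ; _≤_; mkℚ; ↥_; ↧_; ↧ₙ_; 0ℚ)
open import Data.Product using (Σ; _×_; ∃; _,_; proj₁; proj₂)
open import Relation.Binary.PropositionalEquality
  using (_≡_; _≢_; refl; sym; trans; cong; cong₂; subst; subst₂; module ≡-Reasoning)

open import Data.Empty using (⊥-elim)
open import Data.Integer as ℤ using (ℤ; +_; -[1+_]; +[1+_]; +≤+; +<+)
import Data.Integer.DivMod as ℤDM
import Data.Integer.Divisibility.Signed as ℤS
import Data.Integer.Properties as ℤP
open import Data.Integer.Tactic.RingSolver using (solve-∀; solve)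
open import Data.List using (_∷_; [])
open import Data.Nat as ℕ using (ℕ; zero; suc; s≤s; z≤n)
import Data.Nat.Coprimality as ℕC
import Data.Nat.Divisibility as ℕD
import Data.Nat.GCD as ℕG
import Data.Nat.Properties as ℕP
import Data.Rational.Properties as ℚP
open import Data.Rational.Unnormalised as ℚᵘ using (mkℚᵘ)
import Data.Rational.Unnormalised.Properties as ℚᵘP
open import Data.Sum using (_⊎_; inj₁; inj₂)
open import Function.Base using (_∘_)
open import Function.Bundles using (_⇔_; mk⇔; Equivalence)
open import Function.Properties.Equivalence using () renaming (trans to ⇔-trans)
open import Level using (0ℓ)
open import Relation.Nullary using (¬_)
open import Relation.Nullary.Decidable using (dec⇒maybe)
import Tactic.RingSolver as RingSolver
open import Tactic.RingSolver.Core.AlmostCommutativeRing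
  using (AlmostCommutativeRing; fromCommutativeRing)

-- ℚ's operations do not compute on open terms, so the solver needs a decidable zero test
-- to normalise the constant coefficients it produces.
ℚ-ring : AlmostCommutativeRing 0ℓ 0ℓ
ℚ-ring = fromCommutativeRing ℚP.+-*-commutativeRing (λ x → dec⇒maybe (0ℚ ℚP.≟ x))

IsUnit : ℤ → Set
IsUnit σ = σ ≡ + 1 ⊎ σ ≡ ℤ.- + 1

unit*unit : ∀ {σ} → IsUnit σ → σ ℤ.* σ ≡ + 1
unit*unit (inj₁ refl) = refl
unit*unit (inj₂ refl) = refl

unit≢0 : ∀ {σ} → IsUnit σ → σ ≢ + 0
unit≢0 (inj₁ refl) ()
unit≢0 (inj₂ refl) ()

positive-suc : ∀ {i} → + 0 ℤ.< i → Σ ℕ λ n → i ≡ + suc n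
positive-suc {+[1+ n ]} _ = n , refl
positive-suc {+ zero} (+<+ ())

*-pos : ∀ {a b} → + 0 ℤ.< a → + 0 ℤ.< b → + 0 ℤ.< a ℤ.* b
*-pos 0<a 0<b with positive-suc 0<a | positive-suc 0<b
... | _ , refl | _ , refl = +<+ (s≤s z≤n)

*-cancelˡ-pos : ∀ {k x} → + 0 ℤ.< k → + 0 ℤ.< k ℤ.* x → + 0 ℤ.< x
*-cancelˡ-pos {k} {x} 0<k 0<kx =
  ℤP.*-cancelˡ-<-nonNeg k (subst (ℤ._< k ℤ.* x) (sym (ℤP.*-zeroʳ k)) 0<kx)
  where instance _ = ℤ.nonNegative (ℤP.<⇒≤ 0<k)

*-neg⇔ : ∀ {k y} → + 0 ℤ.< k → (k ℤ.* y ℤ.< + 0 ⇔ y ℤ.< + 0)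
*-neg⇔ {k} {y} 0<k = mk⇔
  (λ ky<0 → ℤP.*-cancelˡ-<-nonNeg k (subst (k ℤ.* y ℤ.<_) (sym (ℤP.*-zeroʳ k)) ky<0))
  (λ y<0 → subst (k ℤ.* y ℤ.<_) (ℤP.*-zeroʳ k) (ℤP.*-monoˡ-<-pos k y<0))
  where
  instance
    _ = ℤ.positive 0<k
    _ = ℤ.nonNegative (ℤP.<⇒≤ 0<k)

*-cancelʳ-≤⇔ : ∀ {n a b} → + 0 ℤ.< n → (a ℤ.* n ℤ.≤ b ℤ.* n ⇔ a ℤ.≤ b)
*-cancelʳ-≤⇔ {n} {a} {b} 0<n = mk⇔ (ℤP.*-cancelʳ-≤-pos a b n) (ℤP.*-monoʳ-≤-nonNeg n)
  where
  instance
    _ = ℤ.positive 0<n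
    _ = ℤ.nonNegative (ℤP.<⇒≤ 0<n)

square-nonNeg : ∀ a → + 0 ℤ.≤ a ℤ.* a
square-nonNeg (+ n)    = subst (+ 0 ℤ.≤_) (ℤP.pos-* n n) (+≤+ z≤n)
square-nonNeg -[1+ n ] = +≤+ z≤n

square-antimono-≤ : ∀ {a b} → a ℤ.≤ b → b ℤ.≤ + 0 → b ℤ.* b ℤ.≤ a ℤ.* a
square-antimono-≤ {a} {b} a≤b b≤0 = begin
  b ℤ.* b   ≤⟨ ℤP.*-monoˡ-≤-nonPos b a≤b ⟩
  b ℤ.* a   ≡⟨ ℤP.*-comm b a ⟩
  a ℤ.* b   ≤⟨ ℤP.*-monoˡ-≤-nonPos a a≤b ⟩
  a ℤ.* a   ∎
  where
  open ℤP.≤-Reasoning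
  instance
    _ = ℤ.nonPositive b≤0
    _ = ℤ.nonPositive (ℤP.≤-trans a≤b b≤0)

square-antimono-< : ∀ {a b} → a ℤ.< b → b ℤ.≤ + 0 → b ℤ.* b ℤ.< a ℤ.* a
square-antimono-< {a} {b} a<b b≤0 = begin-strict
  b ℤ.* b   ≤⟨ ℤP.*-monoˡ-≤-nonPos b (ℤP.<⇒≤ a<b) ⟩
  b ℤ.* a   ≡⟨ ℤP.*-comm b a ⟩
  a ℤ.* b   <⟨ ℤP.*-monoˡ-<-neg a a<b ⟩
  a ℤ.* a   ∎
  where
  open ℤP.≤-Reasoning
  instance
    _ = ℤ.nonPositive b≤0
    _ = ℤ.negative (ℤP.<-≤-trans a<b b≤0)

pos-difference : ∀ {a b} → 1 ℕ.+ b ≡ a → + a ℤ.- + b ≡ + 1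
pos-difference {b = b} refl = cancel (+ b)
  where
  cancel : ∀ k → + 1 ℤ.+ k ℤ.- k ≡ + 1
  cancel = solve-∀

signed-abs : ∀ z → Σ ℤ λ s → IsUnit s × z ≡ s ℤ.* + ℤ.∣ z ∣
signed-abs (+ n)    = + 1 , inj₁ refl , sym (ℤP.*-identityˡ (+ n))
signed-abs -[1+ n ] = ℤ.- + 1 , inj₂ refl , sym (ℤP.-1*i≡-i (+ suc n))

sign-normalise : ∀ z → z ≢ + 0 → Σ ℤ λ σ → IsUnit σ × Σ ℕ λ d → σ ℤ.* z ≡ + suc d
sign-normalise (+ zero)  z≢0 = ⊥-elim (z≢0 refl)
sign-normalise +[1+ n ] _   = + 1 , inj₁ refl , _ , refl
sign-normalise -[1+ n ] _   = ℤ.- + 1 , inj₂ refl , _ , refl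

ι≡mkℚ : ∀ z → ι z ≡ mkℚ z 0 (ℕC.sym (ℕC.1-coprimeTo ℤ.∣ z ∣))
ι≡mkℚ z = ℚP.↥p/↧p≡p (mkℚ z 0 _)

↥-ι : ∀ z → ↥ ι z ≡ z
↥-ι z = cong ↥_ (ι≡mkℚ z)

ι-* : ∀ a b → ι (a ℤ.* b) ≡ ι a ℚ.* ι b
ι-* a b = sym (cong₂ ℚ._*_ (ι≡mkℚ a) (ι≡mkℚ b))

ι-+ : ∀ a b → ι (a ℤ.+ b) ≡ ι a ℚ.+ ι b
ι-+ a b = begin
  ι (a ℤ.+ b)                    ≡⟨ cong ι (cong₂ ℤ._+_ (sym (ℤP.*-identityʳ a)) (sym (ℤP.*-identityʳ b))) ⟩
  ι (a ℤ.* + 1 ℤ.+ b ℤ.* + 1)    ≡⟨ sym (cong₂ ℚ._+_ (ι≡mkℚ a) (ι≡mkℚ b)) ⟩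
  ι a ℚ.+ ι b                    ∎
  where open ≡-Reasoning

ι-neg : ∀ a → ι (ℤ.- a) ≡ ℚ.- ι a
ι-neg (+ zero)  = refl
ι-neg +[1+ n ]  = refl
ι-neg -[1+ n ]  = neg-involutive (ι +[1+ n ])
  where
  neg-involutive : ∀ p → p ≡ ℚ.- (ℚ.- p)
  neg-involutive = RingSolver.solve-∀ ℚ-ring

ι-- : ∀ a b → ι (a ℤ.- b) ≡ ι a ℚ.- ι b
ι-- a b = trans (ι-+ a (ℤ.- b)) (cong (ι a ℚ.+_) (ι-neg b))

ι-injective : ∀ {a b} → ι a ≡ ι b → a ≡ b
ι-injective {a} {b} e = trans (sym (↥-ι a)) (trans (cong ↥_ e) (↥-ι b))

ι-mono-≤ : ∀ {a b} → a ℤ.≤ b → ι a ℚ.≤ ι b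
ι-mono-≤ {a} {b} a≤b =
  subst₂ ℚ._≤_ (sym (ι≡mkℚ a)) (sym (ι≡mkℚ b)) (ℚ.*≤* (ℤP.*-monoʳ-≤-nonNeg (+ 1) a≤b))

ι-cancel-≤ : ∀ {a b} → ι a ℚ.≤ ι b → a ℤ.≤ b
ι-cancel-≤ {a} {b} ιa≤ιb with subst₂ ℚ._≤_ (ι≡mkℚ a) (ι≡mkℚ b) ιa≤ιb
... | ℚ.*≤* a*1≤b*1 = ℤP.*-cancelʳ-≤-pos a b (+ 1) a*1≤b*1

ι-mono-< : ∀ {a b} → a ℤ.< b → ι a ℚ.< ι b
ι-mono-< {a} {b} a<b =
  subst₂ ℚ._<_ (sym (ι≡mkℚ a)) (sym (ι≡mkℚ b)) (ℚ.*<* (ℤP.*-monoʳ-<-pos (+ 1) a<b))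

ι-positive : ∀ {a} → + 0 ℤ.< a → ℚ.Positive (ι a)
ι-positive 0<a = ℚ.positive (ι-mono-< 0<a)

/-ratio : ∀ z n → (z ℚ./ suc n) ℚ.* ι (+ suc n) ≡ ι z
/-ratio z n = ℚP.toℚᵘ-injective (begin
  ℚ.toℚᵘ (z ℚ./ suc n ℚ.* ι (+ suc n))
    ≈⟨ ℚP.toℚᵘ-homo-* (z ℚ./ suc n) (ι (+ suc n)) ⟩
  ℚ.toℚᵘ (z ℚ./ suc n) ℚᵘ.* ℚ.toℚᵘ (ι (+ suc n))
    ≈⟨ ℚᵘP.*-cong (ℚP.toℚᵘ-fromℚᵘ (mkℚᵘ z n)) (ℚP.toℚᵘ-fromℚᵘ (mkℚᵘ (+ suc n) 0)) ⟩
  mkℚᵘ z n ℚᵘ.* mkℚᵘ (+ suc n) 0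
    ≈⟨ ℚᵘ.*≡* (trans (cancel z (+ suc n)) (cong (z ℤ.*_) (ℤP.pos-* (suc n) 1))) ⟩
  mkℚᵘ z 0
    ≈⟨ ℚᵘP.≃-sym (ℚP.toℚᵘ-fromℚᵘ (mkℚᵘ z 0)) ⟩
  ℚ.toℚᵘ (ι z) ∎)
  where
  open ℚᵘP.≃-Reasoning
  cancel : ∀ z d → (z ℤ.* d) ℤ.* + 1 ≡ z ℤ.* (d ℤ.* + 1)
  cancel = solve-∀

ratio-↥↧ : ∀ p → p ℚ.* ι (↧ p) ≡ ι (↥ p)
ratio-↥↧ p = subst (λ r → r ℚ.* ι (↧ p) ≡ ι (↥ p)) (ℚP.↥p/↧p≡p p) (/-ratio (↥ p) (ℚ.denominator-1 p))

ratio-exists : ∀ {n} → + 0 ℤ.< n → ∀ m → ∃ λ q → q ℚ.* ι n ≡ ι m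
ratio-exists 0<n m with positive-suc 0<n
... | d , refl = m ℚ./ suc d , /-ratio m d

ratio-injective : ∀ {p q n m} → + 0 ℤ.< n → p ℚ.* ι n ≡ ι m → q ℚ.* ι n ≡ ι m → p ≡ q
ratio-injective {n = n} 0<n pn≡m qn≡m = ℚP.≤-antisym (cancel pn≡qn) (cancel (sym pn≡qn))
  where
  instance _ = ι-positive 0<n
  pn≡qn = trans pn≡m (sym qn≡m)
  cancel : ∀ {r s} → r ℚ.* ι n ≡ s ℚ.* ι n → r ℚ.≤ s
  cancel e = ℚP.*-cancelʳ-≤-pos (ι n) (ℚP.≤-reflexive e)

ratio-scale : ∀ {q n m} k → q ℚ.* ι n ≡ ι m → q ℚ.* ι (k ℤ.* n) ≡ ι (k ℤ.* m)
ratio-scale {q} {n} {m} k qn≡m = begin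
  q ℚ.* ι (k ℤ.* n)     ≡⟨ cong (q ℚ.*_) (ι-* k n) ⟩
  q ℚ.* (ι k ℚ.* ι n)   ≡⟨ swap q (ι k) (ι n) ⟩
  ι k ℚ.* (q ℚ.* ι n)   ≡⟨ cong (ι k ℚ.*_) qn≡m ⟩
  ι k ℚ.* ι m           ≡⟨ sym (ι-* k m) ⟩
  ι (k ℤ.* m)           ∎
  where
  open ≡-Reasoning
  swap : ∀ x y z → x ℚ.* (y ℚ.* z) ≡ y ℚ.* (x ℚ.* z)
  swap = RingSolver.solve-∀ ℚ-ring

ratio⇒cross : ∀ {q n m} → q ℚ.* ι n ≡ ι m → ↥ q ℤ.* n ≡ m ℤ.* ↧ q
ratio⇒cross {q} {n} {m} qn≡m = ι-injective (begin
  ι (↥ q ℤ.* n)              ≡⟨ ι-* (↥ q) n ⟩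
  ι (↥ q) ℚ.* ι n            ≡⟨ cong (ℚ._* ι n) (sym (ratio-↥↧ q)) ⟩
  q ℚ.* ι (↧ q) ℚ.* ι n      ≡⟨ swap q (ι (↧ q)) (ι n) ⟩
  q ℚ.* ι n ℚ.* ι (↧ q)      ≡⟨ cong (ℚ._* ι (↧ q)) qn≡m ⟩
  ι m ℚ.* ι (↧ q)            ≡⟨ sym (ι-* m (↧ q)) ⟩
  ι (m ℤ.* ↧ q)              ∎)
  where
  open ≡-Reasoning
  swap : ∀ x y z → x ℚ.* y ℚ.* z ≡ x ℚ.* z ℚ.* y
  swap = RingSolver.solve-∀ ℚ-ring

1≤ratio : ∀ {q n m} → + 0 ℤ.< n → n ℤ.≤ m → q ℚ.* ι n ≡ ι m → 1ℚ ℚ.≤ q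
1≤ratio {q} {n} {m} 0<n n≤m qn≡m = ℚP.*-cancelʳ-≤-pos (ι n) (begin
  1ℚ ℚ.* ι n   ≡⟨ ℚP.*-identityˡ (ι n) ⟩
  ι n          ≤⟨ ι-mono-≤ n≤m ⟩
  ι m          ≡⟨ sym qn≡m ⟩
  q ℚ.* ι n    ∎)
  where
  instance _ = ι-positive 0<n
  open ℚP.≤-Reasoning

↧≤↥ : ∀ {s} → 1ℚ ℚ.≤ s → ↧ s ℤ.≤ ↥ s
↧≤↥ {s} 1≤s = subst₂ ℤ._≤_ (ℤP.*-identityˡ (↧ s)) (ℤP.*-identityʳ (↥ s)) (ℚP.drop-*≤* 1≤s)

ratio-pos : ∀ {t m} → 0ℚ ℚ.≤ t → t ℚ.* ι m ≡ 1ℚ → + 0 ℤ.< m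
ratio-pos {t} {m} 0≤t tm≡1 = ℤP.≰⇒> λ m≤0 → 1≰0 (ι-cancel-≤ (begin
  ι (+ 1)     ≡⟨ sym tm≡1 ⟩
  t ℚ.* ι m   ≤⟨ ℚP.*-monoˡ-≤-nonNeg t (ι-mono-≤ m≤0) ⟩
  t ℚ.* 0ℚ    ≡⟨ ℚP.*-zeroʳ t ⟩
  ι (+ 0)     ∎))
  where
  instance _ = ℚ.nonNegative 0≤t
  open ℚP.≤-Reasoning
  1≰0 : ¬ (+ 1 ℤ.≤ + 0)
  1≰0 (+≤+ ())

unit-ratio : ∀ {p σ} → σ ℤ.* σ ≡ + 1 → p ℚ.* ι σ ≡ ι σ → p ≡ 1ℚ
unit-ratio {p} {σ} σσ≡1 pσ≡σ = begin
  p                      ≡⟨ sym (ℚP.*-identityʳ p) ⟩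
  p ℚ.* ι (+ 1)          ≡⟨ cong (λ z → p ℚ.* ι z) (sym σσ≡1) ⟩
  p ℚ.* ι (σ ℤ.* σ)      ≡⟨ cong (p ℚ.*_) (ι-* σ σ) ⟩
  p ℚ.* (ι σ ℚ.* ι σ)    ≡⟨ sym (ℚP.*-assoc p (ι σ) (ι σ)) ⟩
  p ℚ.* ι σ ℚ.* ι σ      ≡⟨ cong (ℚ._* ι σ) pσ≡σ ⟩
  ι σ ℚ.* ι σ            ≡⟨ sym (ι-* σ σ) ⟩
  ι (σ ℤ.* σ)            ≡⟨ cong ι σσ≡1 ⟩
  1ℚ                     ∎
  where open ≡-Reasoning

scaled-≤⇔ : ∀ {k m m'} {p p' : ℚ} → + 0 ℤ.< k → ι k ℚ.* p ≡ ι m → ι k ℚ.* p' ≡ ι m' → (p ℚ.≤ p' ⇔ m ℤ.≤ m')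
scaled-≤⇔ {k} 0<k kp≡m kp'≡m' = mk⇔
  (λ p≤p' → ι-cancel-≤ (subst₂ ℚ._≤_ kp≡m kp'≡m' (ℚP.*-monoˡ-≤-nonNeg (ι k) p≤p')))
  (λ m≤m' → ℚP.*-cancelˡ-≤-pos (ι k) (subst₂ ℚ._≤_ (sym kp≡m) (sym kp'≡m') (ι-mono-≤ m≤m')))
  where
  instance
    _ = ι-positive 0<k
    _ = ℚP.pos⇒nonNeg (ι k)

norm² : Pt → ℤ
norm² (a , b) = a ℤ.* a ℤ.+ b ℤ.* b

norm²-pos : ∀ {v} → v ≢ (+ 0 , + 0) → + 0 ℤ.< norm² v
norm²-pos {+ zero   , + zero  } v≢0 = ⊥-elim (v≢0 refl)
norm²-pos {+ zero   , +[1+ n ]} _ = +<+ (s≤s z≤n)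
norm²-pos {+ zero   , -[1+ n ]} _ = +<+ (s≤s z≤n)
norm²-pos {+[1+ m ] , b} _ = ℤP.+-mono-<-≤ (+<+ (s≤s z≤n)) (square-nonNeg b)
norm²-pos { -[1+ m ] , b} _ = ℤP.+-mono-<-≤ (+<+ (s≤s z≤n)) (square-nonNeg b)

·-identityˡ : ∀ u → (+ 1) · u ≡ u
·-identityˡ (a , b) = cong₂ _,_ (ℤP.*-identityˡ a) (ℤP.*-identityˡ b)

⊖-identityʳ : ∀ u → u ⊖ (+ 0 , + 0) ≡ u
⊖-identityʳ (a , b) = cong₂ _,_ (ℤP.+-identityʳ a) (ℤP.+-identityʳ b)

⊕-identityˡ : ∀ u → (+ 0 , + 0) ⊕ u ≡ u
⊕-identityˡ (a , b) = cong₂ _,_ (ℤP.+-identityˡ a) (ℤP.+-identityˡ b)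

⊕-⊖-cancelˡ : ∀ o w → (o ⊕ w) ⊖ o ≡ w
⊕-⊖-cancelˡ (a , b) (c , d) = cong₂ _,_ (cancel a c) (cancel b d)
  where
  cancel : ∀ a c → a ℤ.+ c ℤ.- a ≡ c
  cancel a c = solve (a ∷ c ∷ [])

⊕-⊖-shift : ∀ D v O → (D ⊕ v) ⊖ O ≡ ((+ 1) · v) ⊕ (D ⊖ O)
⊕-⊖-shift (d , e) (a , b) (o , p) = cong₂ _,_ (shift d a o) (shift e b p)
  where
  shift : ∀ d a o → d ℤ.+ a ℤ.- o ≡ + 1 ℤ.* a ℤ.+ (d ℤ.- o)
  shift d a o = solve (d ∷ a ∷ o ∷ [])

zero·⊕ : ∀ v w → ((+ 0) · v) ⊕ w ≡ w
zero·⊕ (a , b) (p , r) = cong₂ _,_ (ℤP.+-identityˡ p) (ℤP.+-identityˡ r)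

act-basis-e₁ : ∀ v w → ((+ 1) · v) ⊕ ((+ 0) · w) ≡ v
act-basis-e₁ (a , b) (p , r) = cong₂ _,_ (coordinate a p) (coordinate b r)
  where
  coordinate : ∀ a p → + 1 ℤ.* a ℤ.+ + 0 ℤ.* p ≡ a
  coordinate a p = solve (a ∷ p ∷ [])

det-zeroʳ : ∀ u → det u (+ 0 , + 0) ≡ + 0
det-zeroʳ (a , b) = expand
  where
  expand : a ℤ.* + 0 ℤ.- b ℤ.* + 0 ≡ + 0
  expand = solve (a ∷ b ∷ [])

det-e₁ : ∀ u → det (+ 1 , + 0) u ≡ proj₂ u
det-e₁ (a , b) = expand
  where
  expand : + 1 ℤ.* b ℤ.- + 0 ℤ.* a ≡ b
  expand = solve (a ∷ b ∷ [])

det-·ʳ : ∀ k u u' → det u (k · u') ≡ k ℤ.* det u u'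
det-·ʳ k (a , b) (c , d) = expand
  where
  expand : a ℤ.* (k ℤ.* d) ℤ.- b ℤ.* (k ℤ.* c) ≡ k ℤ.* (a ℤ.* d ℤ.- b ℤ.* c)
  expand = solve (k ∷ a ∷ b ∷ c ∷ d ∷ [])

det-·-· : ∀ k l u u' → det (k · u) (l · u') ≡ k ℤ.* l ℤ.* det u u'
det-·-· k l (a , b) (c , d) = expand
  where
  expand : (k ℤ.* a) ℤ.* (l ℤ.* d) ℤ.- (k ℤ.* b) ℤ.* (l ℤ.* c) ≡ k ℤ.* l ℤ.* (a ℤ.* d ℤ.- b ℤ.* c)
  expand = solve (k ∷ l ∷ a ∷ b ∷ c ∷ d ∷ [])

det-on-line : ∀ c v w → det v ((c · v) ⊕ w) ≡ det v w
det-on-line c (a , b) (p , r) = expand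
  where
  expand : a ℤ.* (c ℤ.* b ℤ.+ r) ℤ.- b ℤ.* (c ℤ.* a ℤ.+ p) ≡ a ℤ.* r ℤ.- b ℤ.* p
  expand = solve (c ∷ a ∷ b ∷ p ∷ r ∷ [])

det-along : ∀ K x₁ x₂ v w → det v (K · ((x₁ · v) ⊕ (x₂ · w))) ≡ K ℤ.* x₂ ℤ.* det v w
det-along K x₁ x₂ (a , b) (p , r) = expand
  where
  expand : a ℤ.* (K ℤ.* (x₁ ℤ.* b ℤ.+ x₂ ℤ.* r)) ℤ.- b ℤ.* (K ℤ.* (x₁ ℤ.* a ℤ.+ x₂ ℤ.* p))
         ≡ K ℤ.* x₂ ℤ.* (a ℤ.* r ℤ.- b ℤ.* p)
  expand = solve (K ∷ x₁ ∷ x₂ ∷ a ∷ b ∷ p ∷ r ∷ [])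

det-sides : ∀ K x₁ x₂ c v w →
  let v₂ = (x₁ · v) ⊕ (x₂ · w) in
  det v₂ ((c · v) ⊕ w) ℤ.* det v₂ (K · v) ≡ K ℤ.* x₂ ℤ.* (x₂ ℤ.* c ℤ.- x₁) ℤ.* (det v w ℤ.* det v w)
det-sides K x₁ x₂ c (a , b) (p , r) = expand
  where
  expand : ((x₁ ℤ.* a ℤ.+ x₂ ℤ.* p) ℤ.* (c ℤ.* b ℤ.+ r) ℤ.- (x₁ ℤ.* b ℤ.+ x₂ ℤ.* r) ℤ.* (c ℤ.* a ℤ.+ p))
         ℤ.* ((x₁ ℤ.* a ℤ.+ x₂ ℤ.* p) ℤ.* (K ℤ.* b) ℤ.- (x₁ ℤ.* b ℤ.+ x₂ ℤ.* r) ℤ.* (K ℤ.* a))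
         ≡ K ℤ.* x₂ ℤ.* (x₂ ℤ.* c ℤ.- x₁) ℤ.* ((a ℤ.* r ℤ.- b ℤ.* p) ℤ.* (a ℤ.* r ℤ.- b ℤ.* p))
  expand = solve (K ∷ x₁ ∷ x₂ ∷ c ∷ a ∷ b ∷ p ∷ r ∷ [])

offset-vector : ∀ x₁ x₂ c v w → (x₂ · ((c · v) ⊕ w)) ⊖ ((x₁ · v) ⊕ (x₂ · w)) ≡ (x₂ ℤ.* c ℤ.- x₁) · v
offset-vector x₁ x₂ c (a , b) (p , r) = cong₂ _,_ (offset a p) (offset b r)
  where
  offset : ∀ a p → x₂ ℤ.* (c ℤ.* a ℤ.+ p) ℤ.- (x₁ ℤ.* a ℤ.+ x₂ ℤ.* p) ≡ (x₂ ℤ.* c ℤ.- x₁) ℤ.* a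
  offset a p = solve (x₁ ∷ x₂ ∷ c ∷ a ∷ p ∷ [])

norm²-· : ∀ k u → norm² (k · u) ≡ k ℤ.* k ℤ.* norm² u
norm²-· k (a , b) = expand
  where
  expand : (k ℤ.* a) ℤ.* (k ℤ.* a) ℤ.+ (k ℤ.* b) ℤ.* (k ℤ.* b) ≡ k ℤ.* k ℤ.* (a ℤ.* a ℤ.+ b ℤ.* b)
  expand = solve (k ∷ a ∷ b ∷ [])

cramer : ∀ k u v w → ((k ℤ.* det u w) · v) ⊕ ((k ℤ.* det v u) · w) ≡ (k ℤ.* det v w) · u
cramer k (a , b) (p , r) (g , h) = cong₂ _,_ first second
  where
  first : (k ℤ.* (a ℤ.* h ℤ.- b ℤ.* g)) ℤ.* p ℤ.+ (k ℤ.* (p ℤ.* b ℤ.- r ℤ.* a)) ℤ.* g ≡ (k ℤ.* (p ℤ.* h ℤ.- r ℤ.* g)) ℤ.* a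
  first = solve (k ∷ a ∷ b ∷ p ∷ r ∷ g ∷ h ∷ [])
  second : (k ℤ.* (a ℤ.* h ℤ.- b ℤ.* g)) ℤ.* r ℤ.+ (k ℤ.* (p ℤ.* b ℤ.- r ℤ.* a)) ℤ.* h ≡ (k ℤ.* (p ℤ.* h ℤ.- r ℤ.* g)) ℤ.* b
  second = solve (k ∷ a ∷ b ∷ p ∷ r ∷ g ∷ h ∷ [])

unimodular-coordinates : ∀ {σ} v w → det v w ≡ σ → IsUnit σ →
  ∀ u → u ≡ ((σ ℤ.* det u w) · v) ⊕ ((σ ℤ.* det v u) · w)
unimodular-coordinates {σ} v w det-v-w σ-unit u = begin
  u                                               ≡⟨ sym (·-identityˡ u) ⟩
  (+ 1) · u                                       ≡⟨ cong (_· u) (sym (unit*unit σ-unit)) ⟩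
  (σ ℤ.* σ) · u                                   ≡⟨ cong (λ d → (σ ℤ.* d) · u) (sym det-v-w) ⟩
  (σ ℤ.* det v w) · u                             ≡⟨ sym (cramer σ u v w) ⟩
  ((σ ℤ.* det u w) · v) ⊕ ((σ ℤ.* det v u) · w)   ∎
  where open ≡-Reasoning

shear : ∀ {y} x₁ j d v w → y ≡ x₁ ℤ.+ j ℤ.* d → (y · v) ⊕ (d · w) ≡ (x₁ · v) ⊕ (d · ((j · v) ⊕ w))
shear x₁ j d (a , b) (p , r) refl = cong₂ _,_ (coordinate a p) (coordinate b r)
  where
  coordinate : ∀ a p → (x₁ ℤ.+ j ℤ.* d) ℤ.* a ℤ.+ d ℤ.* p ≡ x₁ ℤ.* a ℤ.+ d ℤ.* (j ℤ.* a ℤ.+ p)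
  coordinate a p = solve (x₁ ∷ j ∷ d ∷ a ∷ p ∷ [])

rescale : ∀ {x₁ x₂ n m} k v w → m ℤ.* x₁ ≡ x₂ ℤ.* n →
  (k ℤ.* x₁) · ((n · v) ⊕ (m · w)) ≡ n · (k · ((x₁ · v) ⊕ (x₂ · w)))
rescale {x₁} {x₂} {n} {m} k (a , b) (p , r) mx₁≡x₂n = cong₂ _,_ (coordinate a p) (coordinate b r)
  where
  coordinate : ∀ a p → (k ℤ.* x₁) ℤ.* (n ℤ.* a ℤ.+ m ℤ.* p) ≡ n ℤ.* (k ℤ.* (x₁ ℤ.* a ℤ.+ x₂ ℤ.* p))
  coordinate a p = begin
    (k ℤ.* x₁) ℤ.* (n ℤ.* a ℤ.+ m ℤ.* p)        ≡⟨ solve (k ∷ x₁ ∷ n ∷ m ∷ a ∷ p ∷ []) ⟩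
    k ℤ.* (x₁ ℤ.* n ℤ.* a ℤ.+ (m ℤ.* x₁) ℤ.* p) ≡⟨ cong (λ z → k ℤ.* (x₁ ℤ.* n ℤ.* a ℤ.+ z ℤ.* p)) mx₁≡x₂n ⟩
    k ℤ.* (x₁ ℤ.* n ℤ.* a ℤ.+ (x₂ ℤ.* n) ℤ.* p) ≡⟨ solve (k ∷ x₁ ∷ x₂ ∷ n ∷ a ∷ p ∷ []) ⟩
    n ℤ.* (k ℤ.* (x₁ ℤ.* a ℤ.+ x₂ ℤ.* p))        ∎
    where open ≡-Reasoning

_⊛_ : ℚ → PtQ → PtQ
k ⊛ (a , b) = (k ℚ.* a , k ℚ.* b)

ι-det : ∀ u u' → ι (det u u') ≡ detQ (ιP u) (ιP u')
ι-det (a , b) (c , d) = begin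
  ι (a ℤ.* d ℤ.- b ℤ.* c)             ≡⟨ ι-- (a ℤ.* d) (b ℤ.* c) ⟩
  ι (a ℤ.* d) ℚ.- ι (b ℤ.* c)         ≡⟨ cong₂ ℚ._-_ (ι-* a d) (ι-* b c) ⟩
  ι a ℚ.* ι d ℚ.- ι b ℚ.* ι c         ∎
  where open ≡-Reasoning

detQ-ray : ∀ t u b → detQ (ιP u) (t ⊛ ιP b) ≡ t ℚ.* ι (det u b)
detQ-ray t u@(a , c) b@(d , e) = begin
  ι a ℚ.* (t ℚ.* ι e) ℚ.- ι c ℚ.* (t ℚ.* ι d)   ≡⟨ pull t (ι a) (ι c) (ι d) (ι e) ⟩
  t ℚ.* detQ (ιP u) (ιP b)                       ≡⟨ cong (t ℚ.*_) (sym (ι-det u b)) ⟩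
  t ℚ.* ι (det u b)                              ∎
  where
  open ≡-Reasoning
  pull : ∀ t a c d e → a ℚ.* (t ℚ.* e) ℚ.- c ℚ.* (t ℚ.* d) ≡ t ℚ.* (a ℚ.* e ℚ.- c ℚ.* d)
  pull = RingSolver.solve-∀ ℚ-ring

scaled-offset : ∀ {p o : ℤ} {q t : ℚ} {K x y : ℤ} →
  q ℚ.- ι o ≡ t ℚ.* ι (K ℤ.* y) → t ℚ.* ι (K ℤ.* x) ≡ 1ℚ →
  ι x ℚ.* (ι p ℚ.- q) ≡ ι (x ℤ.* (p ℤ.- o) ℤ.- y)
scaled-offset {p} {o} {q} {t} {K} {x} {y} q-o≡ tKx≡1 = begin
  ι x ℚ.* (ι p ℚ.- q)
    ≡⟨ split (ι x) (ι p) (ι o) q ⟩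
  ι x ℚ.* (ι p ℚ.- ι o) ℚ.- ι x ℚ.* (q ℚ.- ι o)
    ≡⟨ cong (λ z → ι x ℚ.* (ι p ℚ.- ι o) ℚ.- ι x ℚ.* z) (trans q-o≡ (cong (t ℚ.*_) (ι-* K y))) ⟩
  ι x ℚ.* (ι p ℚ.- ι o) ℚ.- ι x ℚ.* (t ℚ.* (ι K ℚ.* ι y))
    ≡⟨ cong (λ z → ι x ℚ.* (ι p ℚ.- ι o) ℚ.- z) (regroup (ι x) t (ι K) (ι y)) ⟩
  ι x ℚ.* (ι p ℚ.- ι o) ℚ.- t ℚ.* (ι K ℚ.* ι x) ℚ.* ι y
    ≡⟨ cong (λ z → ι x ℚ.* (ι p ℚ.- ι o) ℚ.- z ℚ.* ι y) (trans (cong (t ℚ.*_) (sym (ι-* K x))) tKx≡1) ⟩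
  ι x ℚ.* (ι p ℚ.- ι o) ℚ.- 1ℚ ℚ.* ι y
    ≡⟨ cong₂ ℚ._-_ (cong (ι x ℚ.*_) (sym (ι-- p o))) (ℚP.*-identityˡ (ι y)) ⟩
  ι x ℚ.* ι (p ℤ.- o) ℚ.- ι y
    ≡⟨ cong (ℚ._- ι y) (sym (ι-* x (p ℤ.- o))) ⟩
  ι (x ℤ.* (p ℤ.- o)) ℚ.- ι y
    ≡⟨ sym (ι-- (x ℤ.* (p ℤ.- o)) y) ⟩
  ι (x ℤ.* (p ℤ.- o) ℤ.- y) ∎
  where
  open ≡-Reasoning
  split : ∀ x p o q → x ℚ.* (p ℚ.- q) ≡ x ℚ.* (p ℚ.- o) ℚ.- x ℚ.* (q ℚ.- o)
  split = RingSolver.solve-∀ ℚ-ring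
  regroup : ∀ x t k y → x ℚ.* (t ℚ.* (k ℚ.* y)) ≡ t ℚ.* (k ℚ.* x) ℚ.* y
  regroup = RingSolver.solve-∀ ℚ-ring

scaled-dist² : ∀ {O P : Pt} {Q : PtQ} {t : ℚ} {K x : ℤ} {b : Pt} →
  Q ⊖Q ιP O ≡ t ⊛ ιP (K · b) → t ℚ.* ι (K ℤ.* x) ≡ 1ℚ →
  ι (x ℤ.* x) ℚ.* dist² (ιP P) Q ≡ ι (norm² ((x · (P ⊖ O)) ⊖ b))
scaled-dist² {O} {P} {Q} {t} {K} {x} {b} Q-on-ray tKx≡1 = begin
  ι (x ℤ.* x) ℚ.* ((ι Px ℚ.- Qx) ℚ.* (ι Px ℚ.- Qx) ℚ.+ (ι Py ℚ.- Qy) ℚ.* (ι Py ℚ.- Qy))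
    ≡⟨ cong (ℚ._* dist² (ιP P) Q) (ι-* x x) ⟩
  ι x ℚ.* ι x ℚ.* ((ι Px ℚ.- Qx) ℚ.* (ι Px ℚ.- Qx) ℚ.+ (ι Py ℚ.- Qy) ℚ.* (ι Py ℚ.- Qy))
    ≡⟨ distribute (ι x) (ι Px ℚ.- Qx) (ι Py ℚ.- Qy) ⟩
  (ι x ℚ.* (ι Px ℚ.- Qx)) ℚ.* (ι x ℚ.* (ι Px ℚ.- Qx)) ℚ.+ (ι x ℚ.* (ι Py ℚ.- Qy)) ℚ.* (ι x ℚ.* (ι Py ℚ.- Qy))
    ≡⟨ cong₂ (λ X Y → X ℚ.* X ℚ.+ Y ℚ.* Y)
         (scaled-offset {Px} {proj₁ O} {Qx} {t} {K} {x} {proj₁ b} (cong proj₁ Q-on-ray) tKx≡1)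
         (scaled-offset {Py} {proj₂ O} {Qy} {t} {K} {x} {proj₂ b} (cong proj₂ Q-on-ray) tKx≡1) ⟩
  ι ex ℚ.* ι ex ℚ.+ ι ey ℚ.* ι ey
    ≡⟨ sym (trans (ι-+ (ex ℤ.* ex) (ey ℤ.* ey)) (cong₂ ℚ._+_ (ι-* ex ex) (ι-* ey ey))) ⟩
  ι (ex ℤ.* ex ℤ.+ ey ℤ.* ey) ∎
  where
  open ≡-Reasoning
  Px = proj₁ P
  Py = proj₂ P
  Qx = proj₁ Q
  Qy = proj₂ Q
  ex = x ℤ.* (Px ℤ.- proj₁ O) ℤ.- proj₁ b
  ey = x ℤ.* (Py ℤ.- proj₂ O) ℤ.- proj₂ b
  distribute : ∀ k X Y → k ℚ.* k ℚ.* (X ℚ.* X ℚ.+ Y ℚ.* Y) ≡ (k ℚ.* X) ℚ.* (k ℚ.* X) ℚ.+ (k ℚ.* Y) ℚ.* (k ℚ.* Y)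
  distribute = RingSolver.solve-∀ ℚ-ring

-- Frames

-- The angle ∠AOB in a unimodular frame (v , w) at O; in LTan, v is v₁, σ picks the line
-- l = {O + c v + w}, and w = D - O.
record Frame (A O B : Pt) : Set where
  field
    v w     : Pt
    σ       : ℤ
    σ-unit  : IsUnit σ
    det-v-w : det v w ≡ σ
    kA kB   : ℕ
    x₁ x₂   : ℤ
    A-along : A ⊖ O ≡ (+ suc kA) · v
    B-along : B ⊖ O ≡ (+ suc kB) · ((x₁ · v) ⊕ (x₂ · w))

  v₂ : Pt
  v₂ = (x₁ · v) ⊕ (x₂ · w)

  -- x₂ (O + c v + w - Q) = offset c · v, for Q the point where the ray OB meets l.
  offset : ℤ → ℤ
  offset c = x₂ ℤ.* c ℤ.- x₁

Reduced : ∀ {A O B} → Frame A O B → Set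
Reduced f = + 0 ℤ.< x₁ × x₁ ℤ.≤ x₂
  where open Frame f

module FrameProperties {A O B : Pt} (f : Frame A O B) where
  open Frame f

  v≢0 : v ≢ (+ 0 , + 0)
  v≢0 refl = unit≢0 σ-unit (sym det-v-w)

  on-line : ∀ u → det v u ≡ σ → u ≡ ((σ ℤ.* det u w) · v) ⊕ w
  on-line u det-v-u = begin
    u                                               ≡⟨ unimodular-coordinates v w det-v-w σ-unit u ⟩
    ((σ ℤ.* det u w) · v) ⊕ ((σ ℤ.* det v u) · w)   ≡⟨ cong (λ d → ((σ ℤ.* det u w) · v) ⊕ (d · w)) σ-det-v-u ⟩
    ((σ ℤ.* det u w) · v) ⊕ ((+ 1) · w)             ≡⟨ cong (((σ ℤ.* det u w) · v) ⊕_) (·-identityˡ w) ⟩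
    ((σ ℤ.* det u w) · v) ⊕ w                       ∎
    where
    open ≡-Reasoning
    σ-det-v-u : σ ℤ.* det v u ≡ + 1
    σ-det-v-u = trans (cong (σ ℤ.*_) det-v-u) (unit*unit σ-unit)

  detQ-on-ray : ∀ {Q t} → Q ⊖Q ιP O ≡ t ⊛ ιP (B ⊖ O) →
    detQ (ιP v) (Q ⊖Q ιP O) ≡ t ℚ.* ι (+ suc kB ℤ.* x₂) ℚ.* ι σ
  detQ-on-ray {Q} {t} Q-on-ray = begin
    detQ (ιP v) (Q ⊖Q ιP O)                 ≡⟨ cong (detQ (ιP v)) Q-on-ray ⟩
    detQ (ιP v) (t ⊛ ιP (B ⊖ O))            ≡⟨ detQ-ray t v (B ⊖ O) ⟩
    t ℚ.* ι (det v (B ⊖ O))                 ≡⟨ cong (λ b → t ℚ.* ι (det v b)) B-along ⟩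
    t ℚ.* ι (det v ((+ suc kB) · v₂))       ≡⟨ cong (λ z → t ℚ.* ι z) (det-along (+ suc kB) x₁ x₂ v w) ⟩
    t ℚ.* ι (+ suc kB ℤ.* x₂ ℤ.* det v w)   ≡⟨ cong (λ d → t ℚ.* ι (+ suc kB ℤ.* x₂ ℤ.* d)) det-v-w ⟩
    t ℚ.* ι (+ suc kB ℤ.* x₂ ℤ.* σ)         ≡⟨ cong (t ℚ.*_) (ι-* (+ suc kB ℤ.* x₂) σ) ⟩
    t ℚ.* (ι (+ suc kB ℤ.* x₂) ℚ.* ι σ)     ≡⟨ sym (ℚP.*-assoc t _ (ι σ)) ⟩
    t ℚ.* ι (+ suc kB ℤ.* x₂) ℚ.* ι σ       ∎
    where open ≡-Reasoning

  side-product : ∀ P {c} → P ⊖ O ≡ (c · v) ⊕ w →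
    det v₂ (P ⊖ O) ℤ.* det v₂ (A ⊖ O) ≡ (+ suc kA ℤ.* x₂) ℤ.* offset c
  side-product P {c} P-on-line = begin
    det v₂ (P ⊖ O) ℤ.* det v₂ (A ⊖ O)
      ≡⟨ cong₂ (λ p a → det v₂ p ℤ.* det v₂ a) P-on-line A-along ⟩
    det v₂ ((c · v) ⊕ w) ℤ.* det v₂ ((+ suc kA) · v)
      ≡⟨ det-sides (+ suc kA) x₁ x₂ c v w ⟩
    (+ suc kA ℤ.* x₂) ℤ.* offset c ℤ.* (det v w ℤ.* det v w)
      ≡⟨ cong (λ d → (+ suc kA ℤ.* x₂) ℤ.* offset c ℤ.* (d ℤ.* d)) det-v-w ⟩
    (+ suc kA ℤ.* x₂) ℤ.* offset c ℤ.* (σ ℤ.* σ)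
      ≡⟨ cong ((+ suc kA ℤ.* x₂) ℤ.* offset c ℤ.*_) (unit*unit σ-unit) ⟩
    (+ suc kA ℤ.* x₂) ℤ.* offset c ℤ.* + 1
      ≡⟨ ℤP.*-identityʳ _ ⟩
    (+ suc kA ℤ.* x₂) ℤ.* offset c ∎
    where open ≡-Reasoning

  otherSide⇔ : ∀ P {c} → + 0 ℤ.< x₂ → P ⊖ O ≡ (c · v) ⊕ w →
    OtherSide (∠ A O B) v₂ P ⇔ offset c ℤ.< + 0
  otherSide⇔ P {c} 0<x₂ P-on-line =
    subst (λ z → z ℤ.< + 0 ⇔ offset c ℤ.< + 0) (sym (side-product P P-on-line))
      (*-neg⇔ (*-pos {+ suc kA} (+<+ (s≤s z≤n)) 0<x₂))

  offset-zero : offset (+ 0) ≡ ℤ.- x₁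
  offset-zero = trans (cong (ℤ._- x₁) (ℤP.*-zeroʳ x₂)) (ℤP.+-identityˡ (ℤ.- x₁))

  offset-mono-≤ : ∀ {c c'} → + 0 ℤ.< x₂ → c ℤ.≤ c' → offset c ℤ.≤ offset c'
  offset-mono-≤ 0<x₂ c≤c' = ℤP.+-monoˡ-≤ (ℤ.- x₁) (ℤP.*-monoˡ-≤-nonNeg x₂ c≤c')
    where instance _ = ℤ.nonNegative (ℤP.<⇒≤ 0<x₂)

  offset-mono-< : ∀ {c c'} → + 0 ℤ.< x₂ → c ℤ.< c' → offset c ℤ.< offset c'
  offset-mono-< 0<x₂ c<c' = ℤP.+-monoˡ-< (ℤ.- x₁) (ℤP.*-monoˡ-<-pos x₂ c<c')
    where instance _ = ℤ.positive 0<x₂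

  module OnRay {Q : PtQ} {t : ℚ} (Q-on-ray : Q ⊖Q ιP O ≡ t ⊛ ιP (B ⊖ O))
               (t-scale : t ℚ.* ι (+ suc kB ℤ.* x₂) ≡ 1ℚ) where

    dist²-on-line : ∀ P {c} → P ⊖ O ≡ (c · v) ⊕ w →
      ι (x₂ ℤ.* x₂) ℚ.* dist² (ιP P) Q ≡ ι (offset c ℤ.* offset c ℤ.* norm² v)
    dist²-on-line P {c} P-on-line = begin
      ι (x₂ ℤ.* x₂) ℚ.* dist² (ιP P) Q            ≡⟨ scaled-dist² {O} {P} {Q} {t} {+ suc kB} {x₂} {v₂} Q-on-ray-v₂ t-scale ⟩
      ι (norm² ((x₂ · (P ⊖ O)) ⊖ v₂))             ≡⟨ cong (λ u → ι (norm² ((x₂ · u) ⊖ v₂))) P-on-line ⟩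
      ι (norm² ((x₂ · ((c · v) ⊕ w)) ⊖ v₂))       ≡⟨ cong (λ u → ι (norm² u)) (offset-vector x₁ x₂ c v w) ⟩
      ι (norm² (offset c · v))                    ≡⟨ cong ι (norm²-· (offset c) v) ⟩
      ι (offset c ℤ.* offset c ℤ.* norm² v)       ∎
      where
      open ≡-Reasoning
      Q-on-ray-v₂ : Q ⊖Q ιP O ≡ t ⊛ ιP ((+ suc kB) · v₂)
      Q-on-ray-v₂ = trans Q-on-ray (cong (λ b → t ⊛ ιP b) B-along)

    closer⇔ : ∀ P P' {c c'} → + 0 ℤ.< x₂ → P ⊖ O ≡ (c · v) ⊕ w → P' ⊖ O ≡ (c' · v) ⊕ w →
      (dist² (ιP P) Q ℚ.≤ dist² (ιP P') Q ⇔ offset c ℤ.* offset c ℤ.≤ offset c' ℤ.* offset c')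
    closer⇔ P P' 0<x₂ P-on-line P'-on-line = ⇔-trans
      (scaled-≤⇔ (*-pos 0<x₂ 0<x₂) (dist²-on-line P P-on-line) (dist²-on-line P' P'-on-line))
      (*-cancelʳ-≤⇔ (norm²-pos v≢0))

ltan⇒frame : ∀ A O B q → LTan (∠ A O B) q →
  Σ (Frame A O B) λ f → Reduced f × q ℚ.* ι (Frame.x₁ f) ≡ ι (Frame.x₂ f)
ltan⇒frame A O B _
  (v , _ , σ , Q , D , x₁ , x₂ , (_ , kA , A-along) , (_ , kB , B-along) , σ-unit
     , (t , 0≤t , Q-on-ray) , Q-on-l , D-on-l , D-side , D-nearest , refl , _ , ratio) =
  f , (0<x₁ , x₁≤x₂) , ratio
  where
  f : Frame A O B
  f = record { v = v ; w = D ⊖ O ; σ = σ ; σ-unit = σ-unit ; det-v-w = D-on-l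
             ; kA = kA ; kB = kB ; x₁ = x₁ ; x₂ = x₂ ; A-along = A-along ; B-along = B-along }
  open Frame f using (offset)
  open FrameProperties f

  t-scale : t ℚ.* ι (+ suc kB ℤ.* x₂) ≡ 1ℚ
  t-scale = unit-ratio {σ = σ} (unit*unit σ-unit) (trans (sym (detQ-on-ray {Q} {t} Q-on-ray)) Q-on-l)

  open OnRay {Q} {t} Q-on-ray t-scale

  0<x₂ : + 0 ℤ.< x₂
  0<x₂ = *-cancelˡ-pos {+ suc kB} (+<+ (s≤s z≤n)) (ratio-pos 0≤t t-scale)

  D-coordinates : D ⊖ O ≡ ((+ 0) · v) ⊕ (D ⊖ O)
  D-coordinates = sym (zero·⊕ v (D ⊖ O))

  offset₀<0 : offset (+ 0) ℤ.< + 0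
  offset₀<0 = Equivalence.to (otherSide⇔ D 0<x₂ D-coordinates) D-side

  0<x₁ : + 0 ℤ.< x₁
  0<x₁ = ℤP.neg-cancel-< (subst (ℤ._< + 0) offset-zero offset₀<0)

  -- If x₂ < x₁, the lattice point D + v of l would also lie beyond OB, and closer to Q than D.
  x₁≤x₂ : x₁ ℤ.≤ x₂
  x₁≤x₂ = ℤP.≮⇒≥ λ x₂<x₁ →
    let P-side = Equivalence.from (otherSide⇔ P 0<x₂ P-coordinates) (offset₁<0 x₂<x₁)
        D-not-farther = Equivalence.to (closer⇔ D P 0<x₂ D-coordinates P-coordinates) (D-nearest P P-on-l P-side)
        P-closer = square-antimono-< (offset-mono-< 0<x₂ (+<+ (s≤s z≤n))) (ℤP.<⇒≤ (offset₁<0 x₂<x₁))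
    in ℤP.<⇒≱ P-closer D-not-farther
    where
    P = D ⊕ v
    P-coordinates : P ⊖ O ≡ ((+ 1) · v) ⊕ (D ⊖ O)
    P-coordinates = ⊕-⊖-shift D v O
    P-on-l : det v (P ⊖ O) ≡ σ
    P-on-l = trans (cong (det v) P-coordinates) (trans (det-on-line (+ 1) v (D ⊖ O)) D-on-l)
    offset₁<0 : x₂ ℤ.< x₁ → offset (+ 1) ℤ.< + 0
    offset₁<0 x₂<x₁ = subst₂ ℤ._<_ (cong (ℤ._- x₁) (sym (ℤP.*-identityʳ x₂))) (ℤP.+-inverseʳ x₁)
                        (ℤP.+-monoˡ-< (ℤ.- x₁) x₂<x₁)

frame⇒ltan : ∀ {A O B} (f : Frame A O B) → Reduced f →
  Primitive (Frame.v f) → Primitive (Frame.v₂ f) →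
  ∀ q → q ℚ.* ι (Frame.x₁ f) ≡ ι (Frame.x₂ f) → LTan (∠ A O B) q
frame⇒ltan {A} {O} {B} f (0<x₁ , x₁≤x₂) v-primitive v₂-primitive q ratio =
  v , v₂ , σ , Q , D , x₁ , x₂ , (v-primitive , kA , A-along) , (v₂-primitive , kB , B-along) , σ-unit
    , (t , 0≤t , Q-on-ray) , Q-on-l , D-on-l , D-side , D-nearest , v₂-via-D , x₁≢0 , ratio
  where
  open Frame f
  open FrameProperties f

  0<x₂ : + 0 ℤ.< x₂
  0<x₂ = ℤP.<-≤-trans 0<x₁ x₁≤x₂

  scale : ℚ
  scale = ι (+ suc kB ℤ.* x₂)

  instance
    scale-positive : ℚ.Positive scale
    scale-positive = ι-positive (*-pos {+ suc kB} (+<+ (s≤s z≤n)) 0<x₂)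
    scale-nonZero : ℚ.NonZero scale
    scale-nonZero = ℚP.pos⇒nonZero scale

  t : ℚ
  t = ℚ.1/ scale

  0≤t : 0ℚ ℚ.≤ t
  0≤t = ℚP.nonNegative⁻¹ t {{ℚP.pos⇒nonNeg t {{ℚP.1/pos⇒pos scale}}}}

  t-scale : t ℚ.* scale ≡ 1ℚ
  t-scale = ℚP.*-inverseˡ scale

  Q : PtQ
  Q = (ι (proj₁ O) ℚ.+ t ℚ.* ι (proj₁ (B ⊖ O)) , ι (proj₂ O) ℚ.+ t ℚ.* ι (proj₂ (B ⊖ O)))

  Q-on-ray : Q ⊖Q ιP O ≡ t ⊛ ιP (B ⊖ O)
  Q-on-ray = cong₂ _,_ (cancel (ι (proj₁ O)) _) (cancel (ι (proj₂ O)) _)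
    where
    cancel : ∀ o y → o ℚ.+ y ℚ.- o ≡ y
    cancel = RingSolver.solve-∀ ℚ-ring

  Q-on-l : detQ (ιP v) (Q ⊖Q ιP O) ≡ ι σ
  Q-on-l = trans (detQ-on-ray {Q} {t} Q-on-ray) (trans (cong (ℚ._* ι σ) t-scale) (ℚP.*-identityˡ (ι σ)))

  open OnRay {Q} {t} Q-on-ray t-scale

  D : Pt
  D = O ⊕ w

  D⊖O≡w : D ⊖ O ≡ w
  D⊖O≡w = ⊕-⊖-cancelˡ O w

  D-coordinates : D ⊖ O ≡ ((+ 0) · v) ⊕ w
  D-coordinates = trans D⊖O≡w (sym (zero·⊕ v w))

  D-on-l : det v (D ⊖ O) ≡ σ
  D-on-l = trans (cong (det v) D⊖O≡w) det-v-w

  offset₀<0 : offset (+ 0) ℤ.< + 0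
  offset₀<0 = subst (ℤ._< + 0) (sym offset-zero) (ℤP.neg-mono-< 0<x₁)

  D-side : OtherSide (∠ A O B) v₂ D
  D-side = Equivalence.from (otherSide⇔ D 0<x₂ D-coordinates) offset₀<0

  -- A point O + c v + w of l beyond OB has x₂ c < x₁ ≤ x₂, so c ≤ 0 and it is no closer to Q than D.
  D-nearest : ∀ P → det v (P ⊖ O) ≡ σ → OtherSide (∠ A O B) v₂ P → dist² (ιP D) Q ℚ.≤ dist² (ιP P) Q
  D-nearest P P-on-l P-side = Equivalence.from (closer⇔ D P 0<x₂ D-coordinates P-coordinates)
    (square-antimono-≤ (offset-mono-≤ 0<x₂ c≤0) (ℤP.<⇒≤ offset₀<0))
    where
    c = σ ℤ.* det (P ⊖ O) w
    P-coordinates : P ⊖ O ≡ (c · v) ⊕ w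
    P-coordinates = on-line (P ⊖ O) P-on-l
    offset₁≥0 : + 0 ℤ.≤ offset (+ 1)
    offset₁≥0 = subst (λ z → + 0 ℤ.≤ z ℤ.- x₁) (sym (ℤP.*-identityʳ x₂)) (ℤP.i≤j⇒0≤j-i x₁≤x₂)
    c≤0 : c ℤ.≤ + 0
    c≤0 = ℤP.≮⇒≥ λ 0<c → ℤP.<⇒≱ (Equivalence.to (otherSide⇔ P 0<x₂ P-coordinates) P-side)
            (ℤP.≤-trans offset₁≥0 (offset-mono-≤ 0<x₂ (ℤP.i<j⇒suc[i]≤j 0<c)))

  v₂-via-D : v₂ ≡ (x₁ · v) ⊕ (x₂ · (D ⊖ O))
  v₂-via-D = cong (λ u → (x₁ · v) ⊕ (x₂ · u)) (sym D⊖O≡w)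

  x₁≢0 : x₁ ≢ + 0
  x₁≢0 x₁≡0 = ℤP.<⇒≢ 0<x₁ (sym x₁≡0)

frame⇒congruent : ∀ {A O B} (f : Frame A O B) → Reduced f →
  ∀ q → q ℚ.* ι (Frame.x₁ f) ≡ ι (Frame.x₂ f) → (h : 1ℚ ℚ.≤ q) → LatticeCongruent (larctan q h) (∠ A O B)
frame⇒congruent {A} {O} {B} f (0<x₁ , _) q ratio _ = M , O , ⊕-identityˡ O , e₁-direction , B-direction
  where
  open Frame f

  M : GL2Z
  M = mkGL v w (subst IsUnit (sym det-v-w) σ-unit)

  e₁-direction : SameDir (act M ((+ 1 , + 0) ⊖ (+ 0 , + 0))) (A ⊖ O)
  e₁-direction = kA , 0 , (begin
    (+ suc kA) · act M (+ 1 , + 0)   ≡⟨ cong ((+ suc kA) ·_) (act-basis-e₁ v w) ⟩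
    (+ suc kA) · v                   ≡⟨ sym A-along ⟩
    A ⊖ O                            ≡⟨ sym (·-identityˡ (A ⊖ O)) ⟩
    (+ 1) · (A ⊖ O)                  ∎)
    where open ≡-Reasoning

  B-direction : SameDir (act M ((+ ↧ₙ q , ↥ q) ⊖ (+ 0 , + 0))) (B ⊖ O)
  B-direction =
    let k , KBx₁≡ = positive-suc (*-pos {+ suc kB} (+<+ (s≤s z≤n)) 0<x₁)
    in k , ℚ.denominator-1 q , (begin
    (+ suc k) · act M ((↧ q , ↥ q) ⊖ (+ 0 , + 0))   ≡⟨ cong₂ (λ z u → z · act M u) (sym KBx₁≡) (⊖-identityʳ (↧ q , ↥ q)) ⟩
    (+ suc kB ℤ.* x₁) · (((↧ q) · v) ⊕ ((↥ q) · w)) ≡⟨ rescale {x₁} {x₂} {↧ q} {↥ q} (+ suc kB) v w (ratio⇒cross {q} {x₁} {x₂} ratio) ⟩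
    (↧ q) · ((+ suc kB) · v₂)                       ≡⟨ cong ((↧ q) ·_) (sym B-along) ⟩
    (↧ q) · (B ⊖ O)                                 ∎)
    where open ≡-Reasoning

ltan⇒larctan-congruent : ∀ A O B q → LTan (∠ A O B) q →
  Σ (1ℚ ℚ.≤ q) λ h → LatticeCongruent (larctan q h) (∠ A O B)
ltan⇒larctan-congruent A O B q lt =
  let f , reduced@(0<x₁ , x₁≤x₂) , ratio = ltan⇒frame A O B q lt
      1≤q = 1≤ratio 0<x₁ x₁≤x₂ ratio
  in 1≤q , frame⇒congruent f reduced q ratio 1≤q

-- Existence of a reduced frame

primitive-along : ∀ u → u ≢ (+ 0 , + 0) → Σ ℕ λ k → Σ Pt λ v → Primitive v × u ≡ (+ suc k) · v
primitive-along (a , b) u≢0 with ℕG.gcd ℤ.∣ a ∣ ℤ.∣ b ∣ in gcd≡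
... | zero = ⊥-elim (u≢0 (cong₂ _,_ (ℤP.∣i∣≡0⇒i≡0 (ℕG.gcd[m,n]≡0⇒m≡0 gcd≡))
                                    (ℤP.∣i∣≡0⇒i≡0 (ℕG.gcd[m,n]≡0⇒n≡0 ℤ.∣ a ∣ gcd≡))))
... | suc k with divisor (ℕG.gcd[m,n]∣m ℤ.∣ a ∣ ℤ.∣ b ∣) | divisor (ℕG.gcd[m,n]∣n ℤ.∣ a ∣ ℤ.∣ b ∣)
  where
  divisor : ∀ {z} → ℕG.gcd ℤ.∣ a ∣ ℤ.∣ b ∣ ℕD.∣ ℤ.∣ z ∣ → (+ suc k) ℤS.∣ z
  divisor = ℤS.∣ᵤ⇒∣ ∘ subst (ℕD._∣ _) gcd≡
... | ℤS.divides qa a≡ | ℤS.divides qb b≡ =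
  k , (qa , qb) , quotient-primitive , cong₂ _,_ (trans a≡ (ℤP.*-comm qa _)) (trans b≡ (ℤP.*-comm qb _))
  where
  ∣∣-quotient : ∀ {z q} → z ≡ q ℤ.* + suc k → ℤ.∣ z ∣ ≡ suc k ℕ.* ℤ.∣ q ∣
  ∣∣-quotient {q = q} refl = trans (ℤP.abs-* q (+ suc k)) (ℕP.*-comm ℤ.∣ q ∣ (suc k))
  quotient-primitive : ℕG.gcd ℤ.∣ qa ∣ ℤ.∣ qb ∣ ≡ 1
  quotient-primitive = ℕP.*-cancelˡ-≡ _ 1 (suc k) (begin
    suc k ℕ.* ℕG.gcd ℤ.∣ qa ∣ ℤ.∣ qb ∣                   ≡⟨ ℕG.c*gcd[m,n]≡gcd[cm,cn] (suc k) ℤ.∣ qa ∣ ℤ.∣ qb ∣ ⟩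
    ℕG.gcd (suc k ℕ.* ℤ.∣ qa ∣) (suc k ℕ.* ℤ.∣ qb ∣)     ≡⟨ sym (cong₂ ℕG.gcd (∣∣-quotient {q = qa} a≡) (∣∣-quotient {q = qb} b≡)) ⟩
    ℕG.gcd ℤ.∣ a ∣ ℤ.∣ b ∣                               ≡⟨ gcd≡ ⟩
    suc k                                                ≡⟨ sym (ℕP.*-identityʳ (suc k)) ⟩
    suc k ℕ.* 1                                          ∎)
    where open ≡-Reasoning

coprime-bezout : ∀ m n → ℕG.gcd m n ≡ 1 → Σ ℤ λ x → Σ ℤ λ y → x ℤ.* + m ℤ.- y ℤ.* + n ≡ + 1
coprime-bezout m n gcd≡1 with subst (λ d → ℕG.Bézout.Identity d m n) gcd≡1 (ℕG.Bézout.identity (ℕG.gcd-GCD m n))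
... | ℕG.Bézout.+- x y 1+yn≡xm = + x , + y ,
  trans (cong₂ ℤ._-_ (sym (ℤP.pos-* x m)) (sym (ℤP.pos-* y n))) (pos-difference 1+yn≡xm)
... | ℕG.Bézout.-+ x y 1+xm≡yn = ℤ.- + x , ℤ.- + y ,
  trans (negate (+ x) (+ m) (+ y) (+ n))
        (trans (cong₂ ℤ._-_ (sym (ℤP.pos-* y n)) (sym (ℤP.pos-* x m))) (pos-difference 1+xm≡yn))
  where
  negate : ∀ x m y n → ℤ.- x ℤ.* m ℤ.- ℤ.- y ℤ.* n ≡ y ℤ.* n ℤ.- x ℤ.* m
  negate = solve-∀

bezout-completion : ∀ v → Primitive v → Σ Pt λ w → det v w ≡ + 1
bezout-completion (a , b) v-primitive
  with signed-abs a | signed-abs b | coprime-bezout ℤ.∣ a ∣ ℤ.∣ b ∣ v-primitive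
... | s , s-unit , a≡ | s' , s'-unit , b≡ | x , y , bezout = (s' ℤ.* y , s ℤ.* x) , (begin
  a ℤ.* (s ℤ.* x) ℤ.- b ℤ.* (s' ℤ.* y)
    ≡⟨ cong₂ (λ a b → a ℤ.* (s ℤ.* x) ℤ.- b ℤ.* (s' ℤ.* y)) a≡ b≡ ⟩
  (s ℤ.* A) ℤ.* (s ℤ.* x) ℤ.- (s' ℤ.* B) ℤ.* (s' ℤ.* y)
    ≡⟨ regroup s s' A B x y ⟩
  (s ℤ.* s) ℤ.* (x ℤ.* A) ℤ.- (s' ℤ.* s') ℤ.* (y ℤ.* B)
    ≡⟨ cong₂ (λ e e' → e ℤ.* (x ℤ.* A) ℤ.- e' ℤ.* (y ℤ.* B)) (unit*unit s-unit) (unit*unit s'-unit) ⟩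
  + 1 ℤ.* (x ℤ.* A) ℤ.- + 1 ℤ.* (y ℤ.* B)
    ≡⟨ cong₂ ℤ._-_ (ℤP.*-identityˡ (x ℤ.* A)) (ℤP.*-identityˡ (y ℤ.* B)) ⟩
  x ℤ.* A ℤ.- y ℤ.* B
    ≡⟨ bezout ⟩
  + 1 ∎)
  where
  open ≡-Reasoning
  A = + ℤ.∣ a ∣
  B = + ℤ.∣ b ∣
  regroup : ∀ s s' A B x y →
    (s ℤ.* A) ℤ.* (s ℤ.* x) ℤ.- (s' ℤ.* B) ℤ.* (s' ℤ.* y) ≡ (s ℤ.* s) ℤ.* (x ℤ.* A) ℤ.- (s' ℤ.* s') ℤ.* (y ℤ.* B)
  regroup = solve-∀

-- The shear w ↦ j v + w, with j the quotient of y - 1 by d, brings the coefficient of v into [1 , d].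
reduce-coefficient : ∀ y d v w → Σ ℕ λ r → Σ ℤ λ j →
  r ℕ.< suc d × (y · v) ⊕ ((+ suc d) · w) ≡ ((+ suc r) · v) ⊕ ((+ suc d) · ((j · v) ⊕ w))
reduce-coefficient y d v w =
  r , j , ℤDM.n%ℕd<d (y ℤ.- + 1) (suc d) , shear (+ suc r) j (+ suc d) v w y≡
  where
  r = (y ℤ.- + 1) ℤDM.%ℕ suc d
  j = (y ℤ.- + 1) ℤDM./ℕ suc d
  decrement : ∀ y → y ≡ + 1 ℤ.+ (y ℤ.- + 1)
  decrement = solve-∀
  y≡ : y ≡ + suc r ℤ.+ j ℤ.* + suc d
  y≡ = begin
    y                                   ≡⟨ decrement y ⟩
    + 1 ℤ.+ (y ℤ.- + 1)                 ≡⟨ cong (λ z → + 1 ℤ.+ z) (ℤDM.a≡a%ℕn+[a/ℕn]*n (y ℤ.- + 1) (suc d)) ⟩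
    + 1 ℤ.+ (+ r ℤ.+ j ℤ.* + suc d)     ≡⟨ sym (ℤP.+-assoc (+ 1) (+ r) (j ℤ.* + suc d)) ⟩
    + suc r ℤ.+ j ℤ.* + suc d           ∎
    where open ≡-Reasoning

reduced-frame : ∀ {A O B kA kB v v₂ w σ d} → A ⊖ O ≡ (+ suc kA) · v → B ⊖ O ≡ (+ suc kB) · v₂ →
  IsUnit σ → det v w ≡ σ → σ ℤ.* det v v₂ ≡ + suc d →
  Σ (Frame A O B) λ f → Reduced f × Frame.v f ≡ v × Frame.v₂ f ≡ v₂
reduced-frame {A} {O} {B} {kA} {kB} {v} {v₂} {w} {σ} {d} A-along B-along σ-unit det-v-w σ-det-v-v₂
  with reduce-coefficient (σ ℤ.* det v₂ w) d v w
... | r , j , r<d , sheared = f , (+<+ (s≤s z≤n) , +≤+ r<d) , refl , sym v₂-reduced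
  where
  v₂-reduced : v₂ ≡ ((+ suc r) · v) ⊕ ((+ suc d) · ((j · v) ⊕ w))
  v₂-reduced = begin
    v₂                                              ≡⟨ unimodular-coordinates v w det-v-w σ-unit v₂ ⟩
    ((σ ℤ.* det v₂ w) · v) ⊕ ((σ ℤ.* det v v₂) · w) ≡⟨ cong (λ e → ((σ ℤ.* det v₂ w) · v) ⊕ (e · w)) σ-det-v-v₂ ⟩
    ((σ ℤ.* det v₂ w) · v) ⊕ ((+ suc d) · w)        ≡⟨ sheared ⟩
    ((+ suc r) · v) ⊕ ((+ suc d) · ((j · v) ⊕ w))   ∎
    where open ≡-Reasoning

  f : Frame A O B
  f = record { v = v ; w = (j · v) ⊕ w ; σ = σ ; σ-unit = σ-unit ; det-v-w = trans (det-on-line j v w) det-v-w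
             ; kA = kA ; kB = kB ; x₁ = + suc r ; x₂ = + suc d
             ; A-along = A-along ; B-along = trans B-along (cong ((+ suc kB) ·_) v₂-reduced) }

det-along-directions : ∀ {A O B kA kB v v₂} → NonCollinear A O B →
  A ⊖ O ≡ (+ suc kA) · v → B ⊖ O ≡ (+ suc kB) · v₂ → det v v₂ ≢ + 0
det-along-directions {A} {O} {B} {kA} {kB} {v} {v₂} noncollinear A-along B-along det≡0 = noncollinear (begin
  det (A ⊖ O) (B ⊖ O)                          ≡⟨ cong₂ det A-along B-along ⟩
  det ((+ suc kA) · v) ((+ suc kB) · v₂)       ≡⟨ det-·-· (+ suc kA) (+ suc kB) v v₂ ⟩
  + suc kA ℤ.* + suc kB ℤ.* det v v₂           ≡⟨ cong (+ suc kA ℤ.* + suc kB ℤ.*_) det≡0 ⟩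
  + suc kA ℤ.* + suc kB ℤ.* + 0                ≡⟨ ℤP.*-zeroʳ (+ suc kA ℤ.* + suc kB) ⟩
  + 0                                          ∎)
  where open ≡-Reasoning

frame-exists : ∀ A O B → NonCollinear A O B →
  Σ (Frame A O B) λ f → Reduced f × Primitive (Frame.v f) × Primitive (Frame.v₂ f)
frame-exists A O B noncollinear
  with primitive-along (A ⊖ O) (λ A⊖O≡0 → noncollinear (cong (λ a → det a (B ⊖ O)) A⊖O≡0))
     | primitive-along (B ⊖ O) (λ B⊖O≡0 → noncollinear (trans (cong (det (A ⊖ O)) B⊖O≡0) (det-zeroʳ (A ⊖ O))))
... | kA , v , v-primitive , A-along | kB , v₂ , v₂-primitive , B-along
  with sign-normalise (det v v₂) (det-along-directions {A} {O} {B} {kA} {kB} noncollinear A-along B-along)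
... | σ , σ-unit , d , σ-det-v-v₂ =
  let w₀ , det-v-w₀ = bezout-completion v v-primitive
      f , reduced , v≡ , v₂≡ = reduced-frame {A} {O} {B} {kA} {kB} {v} {v₂} {σ · w₀} A-along B-along σ-unit
                                 (trans (det-·ʳ σ v w₀) (trans (cong (σ ℤ.*_) det-v-w₀) (ℤP.*-identityʳ σ)))
                                 σ-det-v-v₂
  in f , reduced , subst Primitive (sym v≡) v-primitive , subst Primitive (sym v₂≡) v₂-primitive

ltan-exists : ∀ A O B → NonCollinear A O B → ∃ (LTan (∠ A O B))
ltan-exists A O B noncollinear =
  let f , reduced , v-primitive , v₂-primitive = frame-exists A O B noncollinear
      q , ratio = ratio-exists (proj₁ reduced) (Frame.x₂ f)
  in q , frame⇒ltan f reduced v-primitive v₂-primitive q ratio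

-- The lattice arctangent

larctan-noncollinear : ∀ {s} → 1ℚ ℚ.≤ s → NonCollinear (+ 1 , + 0) (+ 0 , + 0) (+ ↧ₙ s , ↥ s)
larctan-noncollinear {s} 1≤s det≡0 = ℤP.<⇒≢ 0<↥s (sym ↥s≡0)
  where
  0<↥s : + 0 ℤ.< ↥ s
  0<↥s = ℤP.<-≤-trans (+<+ (s≤s z≤n)) (↧≤↥ 1≤s)
  ↥s≡0 : ↥ s ≡ + 0
  ↥s≡0 = trans (sym (cong proj₂ (⊖-identityʳ (↧ s , ↥ s)))) (trans (sym (det-e₁ ((↧ s , ↥ s) ⊖ (+ 0 , + 0)))) det≡0)

e₁-multiple : ∀ k u → (+ 1 , + 0) ≡ (+ suc k) · u → u ≡ (+ 1 , + 0)
e₁-multiple k u e₁≡ku = begin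
  u               ≡⟨ sym (·-identityˡ u) ⟩
  (+ 1) · u       ≡⟨ cong (λ n → (+ n) · u) (sym 1+k≡1) ⟩
  (+ suc k) · u   ≡⟨ sym e₁≡ku ⟩
  (+ 1 , + 0)     ∎
  where
  open ≡-Reasoning
  1+k≡1 : suc k ≡ 1
  1+k≡1 = ℕP.m*n≡1⇒m≡1 (suc k) ℤ.∣ proj₁ u ∣
            (sym (trans (cong (λ p → ℤ.∣ proj₁ p ∣) e₁≡ku) (ℤP.abs-* (+ suc k) (proj₁ u))))

shift-vanishes : ∀ {x₁ x₂ a} → + 0 ℤ.< x₁ → x₁ ℤ.≤ x₂ →
  + 0 ℤ.< x₁ ℤ.+ x₂ ℤ.* a → x₁ ℤ.+ x₂ ℤ.* a ℤ.≤ x₂ → a ≡ + 0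
shift-vanishes {a = + zero} _ _ _ _ = refl
shift-vanishes {x₁} {x₂} {+[1+ j ]} 0<x₁ x₁≤x₂ _ x₁+x₂a≤x₂ = ⊥-elim (ℤP.<⇒≱ x₂<x₁+x₂a x₁+x₂a≤x₂)
  where
  instance _ = ℤ.nonNegative (ℤP.≤-trans (ℤP.<⇒≤ 0<x₁) x₁≤x₂)
  x₂≤x₂a : x₂ ℤ.≤ x₂ ℤ.* +[1+ j ]
  x₂≤x₂a = subst (ℤ._≤ x₂ ℤ.* +[1+ j ]) (ℤP.*-identityʳ x₂) (ℤP.*-monoˡ-≤-nonNeg x₂ (+≤+ (s≤s z≤n)))
  x₂<x₁+x₂a : x₂ ℤ.< x₁ ℤ.+ x₂ ℤ.* +[1+ j ]
  x₂<x₁+x₂a = subst (ℤ._< x₁ ℤ.+ x₂ ℤ.* +[1+ j ]) (ℤP.+-identityˡ x₂) (ℤP.+-mono-<-≤ 0<x₁ x₂≤x₂a)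
shift-vanishes {x₁} {x₂} { -[1+ j ]} 0<x₁ x₁≤x₂ 0<x₁+x₂a _ = ⊥-elim (ℤP.<⇒≱ 0<x₁+x₂a x₁+x₂a≤0)
  where
  instance _ = ℤ.nonNegative (ℤP.≤-trans (ℤP.<⇒≤ 0<x₁) x₁≤x₂)
  x₂a≤-x₂ : x₂ ℤ.* -[1+ j ] ℤ.≤ ℤ.- x₂
  x₂a≤-x₂ = subst (x₂ ℤ.* -[1+ j ] ℤ.≤_) (trans (ℤP.*-comm x₂ (ℤ.- + 1)) (ℤP.-1*i≡-i x₂))
              (ℤP.*-monoˡ-≤-nonNeg x₂ (ℤ.-≤- z≤n))
  x₁+x₂a≤0 : x₁ ℤ.+ x₂ ℤ.* -[1+ j ] ℤ.≤ + 0
  x₁+x₂a≤0 = ℤP.≤-trans (ℤP.+-monoʳ-≤ x₁ x₂a≤-x₂) (ℤP.i≤j⇒i-j≤0 x₁≤x₂)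

larctan-coefficients : ∀ {K x₁ x₂ a σ} → + 0 ℤ.< K → + 0 ℤ.< x₁ → x₁ ℤ.≤ x₂ → IsUnit σ →
  + 0 ℤ.< K ℤ.* (x₁ ℤ.+ x₂ ℤ.* a) → K ℤ.* (x₁ ℤ.+ x₂ ℤ.* a) ℤ.≤ K ℤ.* (x₂ ℤ.* σ) →
  a ≡ + 0 × σ ≡ + 1
larctan-coefficients {K} {x₁} {x₂} {a} 0<K 0<x₁ x₁≤x₂ (inj₁ refl) 0<n n≤m =
  shift-vanishes 0<x₁ x₁≤x₂ (*-cancelˡ-pos 0<K 0<n)
    (subst (x₁ ℤ.+ x₂ ℤ.* a ℤ.≤_) (ℤP.*-identityʳ x₂) (ℤP.*-cancelˡ-≤-pos _ _ K n≤m))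
  , refl
  where instance _ = ℤ.positive 0<K
larctan-coefficients {K} {x₁} {x₂} 0<K 0<x₁ x₁≤x₂ (inj₂ refl) 0<n n≤m =
  ⊥-elim (ℤP.<-asym (ℤP.<-≤-trans 0<n n≤m) m<0)
  where
  negate : ∀ K x → K ℤ.* (x ℤ.* ℤ.- + 1) ≡ ℤ.- (K ℤ.* x)
  negate = solve-∀
  m<0 : K ℤ.* (x₂ ℤ.* ℤ.- + 1) ℤ.< + 0
  m<0 = subst (ℤ._< + 0) (sym (negate K x₂)) (ℤP.neg-mono-< (*-pos 0<K (ℤP.<-≤-trans 0<x₁ x₁≤x₂)))

-- For larctan s the frame is forced to be v = e₁, w = e₂, σ = 1.
larctan-frame-ratio : ∀ {s} → 1ℚ ℚ.≤ s → (f : Frame (+ 1 , + 0) (+ 0 , + 0) (+ ↧ₙ s , ↥ s)) → Reduced f →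
  s ℚ.* ι (+ suc (Frame.kB f) ℤ.* Frame.x₁ f) ≡ ι (+ suc (Frame.kB f) ℤ.* Frame.x₂ f)
larctan-frame-ratio {s} 1≤s f (0<x₁ , x₁≤x₂) = subst₂ (λ n m → s ℚ.* ι n ≡ ι m) ↧s≡ ↥s≡ (ratio-↥↧ s)
  where
  open Frame f

  v≡e₁ : v ≡ (+ 1 , + 0)
  v≡e₁ = e₁-multiple kA v A-along

  w₂≡σ : proj₂ w ≡ σ
  w₂≡σ = trans (sym (det-e₁ w)) (trans (cong (λ u → det u w) (sym v≡e₁)) det-v-w)

  B-coordinates : (↧ s , ↥ s) ≡ (+ suc kB) · ((x₁ · (+ 1 , + 0)) ⊕ (x₂ · w))
  B-coordinates = trans (sym (⊖-identityʳ (↧ s , ↥ s)))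
    (trans B-along (cong (λ u → (+ suc kB) · ((x₁ · u) ⊕ (x₂ · w))) v≡e₁))

  first : ∀ K x₁ x₂ p → K ℤ.* (x₁ ℤ.* + 1 ℤ.+ x₂ ℤ.* p) ≡ K ℤ.* (x₁ ℤ.+ x₂ ℤ.* p)
  first = solve-∀
  second : ∀ K x₁ x₂ r → K ℤ.* (x₁ ℤ.* + 0 ℤ.+ x₂ ℤ.* r) ≡ K ℤ.* (x₂ ℤ.* r)
  second = solve-∀

  ↧s-coordinate : ↧ s ≡ + suc kB ℤ.* (x₁ ℤ.+ x₂ ℤ.* proj₁ w)
  ↧s-coordinate = trans (cong proj₁ B-coordinates) (first (+ suc kB) x₁ x₂ (proj₁ w))

  ↥s-coordinate : ↥ s ≡ + suc kB ℤ.* (x₂ ℤ.* σ)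
  ↥s-coordinate = trans (cong proj₂ B-coordinates)
    (trans (second (+ suc kB) x₁ x₂ (proj₂ w)) (cong (λ r → + suc kB ℤ.* (x₂ ℤ.* r)) w₂≡σ))

  coefficients : proj₁ w ≡ + 0 × σ ≡ + 1
  coefficients = larctan-coefficients {+ suc kB} (+<+ (s≤s z≤n)) 0<x₁ x₁≤x₂ σ-unit
    (subst (+ 0 ℤ.<_) ↧s-coordinate (+<+ (s≤s z≤n)))
    (subst₂ ℤ._≤_ ↧s-coordinate ↥s-coordinate (↧≤↥ 1≤s))

  drop-zero : ∀ K x₁ x₂ → K ℤ.* (x₁ ℤ.+ x₂ ℤ.* + 0) ≡ K ℤ.* x₁
  drop-zero = solve-∀
  drop-one : ∀ K x₂ → K ℤ.* (x₂ ℤ.* + 1) ≡ K ℤ.* x₂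
  drop-one = solve-∀

  ↧s≡ : ↧ s ≡ + suc kB ℤ.* x₁
  ↧s≡ = trans ↧s-coordinate
    (trans (cong (λ a → + suc kB ℤ.* (x₁ ℤ.+ x₂ ℤ.* a)) (proj₁ coefficients)) (drop-zero (+ suc kB) x₁ x₂))

  ↥s≡ : ↥ s ≡ + suc kB ℤ.* x₂
  ↥s≡ = trans ↥s-coordinate
    (trans (cong (λ r → + suc kB ℤ.* (x₂ ℤ.* r)) (proj₂ coefficients)) (drop-one (+ suc kB) x₂))

ltan-larctan-unique : ∀ {s} (h : 1ℚ ℚ.≤ s) q → LTan (larctan s h) q → q ≡ s
ltan-larctan-unique {s} h q lt =
  let f , reduced@(0<x₁ , _) , ratio = ltan⇒frame (+ 1 , + 0) (+ 0 , + 0) (+ ↧ₙ s , ↥ s) q lt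
      open Frame f
  in ratio-injective {q} {s} {+ suc kB ℤ.* x₁} {+ suc kB ℤ.* x₂} (*-pos {+ suc kB} (+<+ (s≤s z≤n)) 0<x₁)
       (ratio-scale {q} {x₁} {x₂} (+ suc kB) ratio) (larctan-frame-ratio h f reduced)

ltan-larctan : ∀ s (h : 1ℚ ℚ.≤ s) → LTan (larctan s h) s
ltan-larctan s h =
  let q , lt = ltan-exists (+ 1 , + 0) (+ 0 , + 0) (+ ↧ₙ s , ↥ s) (larctan-noncollinear h)
  in subst (LTan (larctan s h)) (ltan-larctan-unique h q lt) lt

proposition1p7 :
    -- (a) ltan (larctan s) = s  (ltan exists and is unique for this angle)
    ((s : ℚ) (h : 1ℚ ≤ s) →
        LTan (larctan s h) s × ((q : ℚ) → LTan (larctan s h) q → q ≡ s))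
    ×
    -- (b) for every ordinary lattice angle α, ltan α exists, and for its value q
    --     (q ≥ 1, so larctan q is defined) larctan q is lattice-congruent to α
    ((A O B : Pt) → NonCollinear A O B →
        ∃ (λ q → LTan (∠ A O B) q)
      × ((q : ℚ) → LTan (∠ A O B) q →
           Σ (1ℚ ≤ q) λ h → LatticeCongruent (larctan q h) (∠ A O B)))
proposition1p7 =
    (λ s h → ltan-larctan s h , ltan-larctan-unique h)
  , λ A O B noncollinear → ltan-exists A O B noncollinear , ltan⇒larctan-congruent A O B
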